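{- Let $\mathbf d=(d_1\le\dots\le d_n)$ with $d_i\ge2$, let $\nu_2$ be the number of $i$ with $d_i=2$ (so $d_i=2$ exactly for $i\le\nu_2$), and let $F$ be a uniformly random pairing of the configuration points $W$. Let $K_F$ be the kernel of the multigraph $G_F$. Then $K_F$ has the same distribution as the configuration multigraph obtained from a uniformly random pairing of the point set $\hat W=W_{\nu_2+1}\cup W_{\nu_2+2}\cup\cdots\cup W_n$.
   Context: Configuration model: with $2m=\sum_i d_i$, let $W=[2m]$ be partitioned into cells $W_i=[d_1+\dots+d_{i-1}+1,\,d_1+\dots+d_i]$, $i\in[n]$, and let $\varphi(w)=i$ for $w\in W_i$. A pairing $F$ of $W$ (a partition into $m$ pairs) gives a multigraph $G_F$ on $[n]$ with an edge $(\varphi(u),\varphi(v))$ for each pair $\{u,v\}\in F$; for a subset of points (a union of cells) the configuration multigraph is defined in the same way from a pairing of that subset. The kernel $K_F$ is obtained from $G_F$ by repeatedly replacing induced paths of length two (through a vertex of degree 2) by single edges; its vertices are the vertices of degree at least 3. -}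

module Defs where

open import Data.Nat using (ℕ; zero; suc; _+_; _∸_; _≤ᵇ_; _≡ᵇ_; _<ᵇ_)
open import Data.Bool using (Bool; true; false; if_then_else_; _∧_; _∨_)
open import Data.List using (List; []; _∷_; map; concatMap; filterᵇ; length; upTo; _++_; foldl)
open import Data.Nat.ListAction using (sum)
open import Data.Bool.ListAction using (all)
open import Data.Product using (_×_; _,_)

-- Configuration points are 1 .. 2m; vertices are 1 .. n.
Edge : Set
Edge = ℕ × ℕ

-- A multigraph is given by its list of edges (unordered pairs, loops allowed).
MG : Set
MG = List Edge

-- φ d w : the vertex i such that w ∈ W_i = [d_1+…+d_{i-1}+1, d_1+…+d_i].
φ : List ℕ → ℕ → ℕ
φ [] w = 0
φ (d ∷ ds) w = if w ≤ᵇ d then 1 else suc (φ ds (w ∸ d))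

points : List ℕ → List ℕ
points d = map suc (upTo (sum d))

pointsAbove : List ℕ → ℕ → List ℕ
pointsAbove d k = filterᵇ (λ w → k <ᵇ φ d w) (points d)

nu2 : List ℕ → ℕ
nu2 d = length (filterᵇ (λ x → x ≡ᵇ 2) d)

picks : {A : Set} → List A → List (A × List A)
picks [] = []
picks (x ∷ xs) = (x , xs) ∷ map (λ { (y , r) → (y , x ∷ r) }) (picks xs)

-- enumeration (without repetition) of all pairings (perfect matchings) of a
-- list of distinct points; the fuel argument is the length of the list.
pairingsF : ℕ → List ℕ → List MG
pairingsF _ [] = [] ∷ []
pairingsF zero (_ ∷ _) = []
pairingsF (suc k) (x ∷ xs) =
  concatMap (λ { (y , r) → map ((x , y) ∷_) (pairingsF k r) }) (picks xs)

pairings : List ℕ → List MG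
pairings xs = pairingsF (length xs) xs

configMG : List ℕ → MG → MG
configMG d F = map (λ { (u , v) → (φ d u , φ d v) }) F

-- degree of v (a loop counts twice)
deg : MG → ℕ → ℕ
deg [] v = 0
deg ((a , b) ∷ es) v =
  (if a ≡ᵇ v then 1 else 0) + (if b ≡ᵇ v then 1 else 0) + deg es v

incident : ℕ → Edge → Bool
incident v (a , b) = (a ≡ᵇ v) ∨ (b ≡ᵇ v)

notIncident : ℕ → Edge → Bool
notIncident v e = if incident v e then false else true

otherEnds : ℕ → MG → List ℕ
otherEnds v [] = []
otherEnds v ((a , b) ∷ es) =
  if a ≡ᵇ v then (if b ≡ᵇ v then otherEnds v es else b ∷ otherEnds v es)
  else (if b ≡ᵇ v then a ∷ otherEnds v es else otherEnds v es)

-- suppress a vertex v of degree 2: a path u - v - w is replaced by the edge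
-- u - w; a loop at v (an isolated cycle through v) is deleted.
suppress : ℕ → MG → MG
suppress v G with otherEnds v G
... | x ∷ y ∷ [] = (x , y) ∷ filterᵇ (notIncident v) G
... | _ = filterᵇ (notIncident v) G

-- kernel of a multigraph on vertices 1..n: repeatedly suppress vertices of
-- degree 2 (suppression does not change other degrees).
kernel : ℕ → MG → MG
kernel n G = foldl (λ H v → if deg H v ≡ᵇ 2 then suppress v H else H) G (map suc (upTo n))

-- equality of multigraphs (as multisets of unordered edges)
edgeEqᵇ : Edge → Edge → Bool
edgeEqᵇ (a , b) (c , e) = ((a ≡ᵇ c) ∧ (b ≡ᵇ e)) ∨ ((a ≡ᵇ e) ∧ (b ≡ᵇ c))

mult : Edge → MG → ℕ
mult e H = length (filterᵇ (edgeEqᵇ e) H)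

sameMG : MG → MG → Bool
sameMG H K = all (λ e → mult e H ≡ᵇ mult e K) (H ++ K)

countᵇ : {A : Set} → (A → Bool) → List A → ℕ
countᵇ p xs = length (filterᵇ p xs)

-- Sorted with all entries at least 2, the degree sequence is d = 2^ν e with every entry of e
-- at least 3, and the kernel procedure suppresses the vertices 1, …, ν in turn. Vertex j + 1
-- owns the points p = 2j + 1 and q = 2j + 2. A pairing either joins p with q, a loop that the
-- suppression deletes, or joins p and q with points a and b, and then the suppression leaves
-- the edge φ(a) φ(b), exactly as if {a, b} were a pair. So each pairing of the r remaining
-- points arises from r + 1 pairings (once through the loop, r times through an ordered marked
-- pair), whatever the multigraph, and the proportion of pairings with a given kernel is
-- unchanged. After ν steps the remaining points are Ŵ and all remaining vertices have degree
-- at least 3, so the procedure stops at the configuration multigraph of Ŵ.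
module Submission where

open import Data.Bool using (Bool; true; false; if_then_else_; _∧_; T; T?)
open import Data.Bool.ListAction using (all; and)
open import Data.Bool.Properties using (∧-comm; ∧-assoc; ∨-comm)
open import Data.Empty using (⊥-elim)
open import Data.List
  using (List; []; _∷_; _++_; map; concat; concatMap; filterᵇ; length; foldl; iterate; applyUpTo; upTo; replicate)
open import Data.List.Membership.Propositional using (_∈_)
open import Data.List.Properties
  using ( filter-++; filter-all; filter-none; length-++; map-cong; map-cong-local; map-upTo
        ; length-replicate; length-iterate)
open import Data.List.Relation.Binary.Permutation.Propositional using (_↭_; ↭-sym; ↭-trans; ↭-refl)
open import Data.List.Relation.Binary.Permutation.Propositional.Properties
  using (↭-length; ↭-singleton-inv; ∈-resp-↭; drop-mid; ++⁺ˡ; shifts)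
open import Data.List.Relation.Unary.All as All using (All; []; _∷_)
import Data.List.Relation.Unary.All.Properties as All
open import Data.List.Relation.Unary.Any using (here; there)
open import Data.List.Relation.Unary.Linked as Linked using (Linked)
open import Data.List.Relation.Unary.Linked.Properties using (Linked⇒All)
open import Data.Nat using (ℕ; zero; suc; _+_; _*_; _∸_; _≤_; _<_; z≤n; s≤s; _≡ᵇ_; _≤ᵇ_; _<ᵇ_)
open import Data.Nat.ListAction using (sum)
open import Data.Nat.ListAction.Properties using (sum-++)
open import Data.Nat.Properties
open import Algebra.Properties.CommutativeSemigroup +-commutativeSemigroup
  using (interchange; x∙yz≈y∙xz)
open import Algebra.Properties.CommutativeSemigroup *-commutativeSemigroup
  using () renaming (x∙yz≈y∙xz to *-x∙yz≈y∙xz)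
open import Data.Product using (_×_; _,_; ∃)
open import Data.Sum using (_⊎_; inj₁; inj₂)
open import Data.Unit using (tt)
open import Function using (_∘_)
open import Relation.Binary.PropositionalEquality

open import Defs

private variable A B : Set

𝟙 : Bool → ℕ
𝟙 b = if b then 1 else 0

∑ : List A → (A → ℕ) → ℕ
∑ [] f = 0
∑ (x ∷ xs) f = f x + ∑ xs f

syntax ∑ xs (λ x → e) = ∑[ x ∈ xs ] e

T⇒≡true : ∀ {b} → T b → b ≡ true
T⇒≡true {true} _ = refl

≡ᵇ-refl : ∀ v → (v ≡ᵇ v) ≡ true
≡ᵇ-refl zero = refl
≡ᵇ-refl (suc v) = ≡ᵇ-refl v

≡ᵇ-false : ∀ {m n} → m ≢ n → (m ≡ᵇ n) ≡ false
≡ᵇ-false {m} {n} m≢n with m ≡ᵇ n in eq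
... | true = ⊥-elim (m≢n (≡ᵇ⇒≡ m n (subst T (sym eq) tt)))
... | false = refl

≡ᵇ-cancelˡ : ∀ k a b → ((k + a) ≡ᵇ (k + b)) ≡ (a ≡ᵇ b)
≡ᵇ-cancelˡ zero a b = refl
≡ᵇ-cancelˡ (suc k) a b = ≡ᵇ-cancelˡ k a b

countᵇ-∷ : (p : A → Bool) (x : A) (xs : List A) →
  countᵇ p (x ∷ xs) ≡ 𝟙 (p x) + countᵇ p xs
countᵇ-∷ p x xs with p x
... | true = refl
... | false = refl

countᵇ-++ : (p : A → Bool) (xs ys : List A) →
  countᵇ p (xs ++ ys) ≡ countᵇ p xs + countᵇ p ys
countᵇ-++ p xs ys =
  trans (cong length (filter-++ (T? ∘ p) xs ys)) (length-++ (filterᵇ p xs))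

countᵇ-map : (p : B → Bool) (g : A → B) (xs : List A) → countᵇ p (map g xs) ≡ countᵇ (p ∘ g) xs
countᵇ-map p g [] = refl
countᵇ-map p g (x ∷ xs) with p (g x)
... | true = cong suc (countᵇ-map p g xs)
... | false = countᵇ-map p g xs

countᵇ-concatMap : (p : B → Bool) (f : A → List B) (xs : List A) →
  countᵇ p (concatMap f xs) ≡ ∑[ x ∈ xs ] countᵇ p (f x)
countᵇ-concatMap p f [] = refl
countᵇ-concatMap p f (x ∷ xs) =
  trans (countᵇ-++ p (f x) (concatMap f xs)) (cong (countᵇ p (f x) +_) (countᵇ-concatMap p f xs))

countᵇ-cong-local : {p q : A → Bool} {xs : List A} →
  All (λ x → p x ≡ q x) xs → countᵇ p xs ≡ countᵇ q xs
countᵇ-cong-local {xs = []} [] = refl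
countᵇ-cong-local {p = p} {q} {x ∷ xs} (e ∷ es) = begin
  countᵇ p (x ∷ xs)        ≡⟨ countᵇ-∷ p x xs ⟩
  𝟙 (p x) + countᵇ p xs    ≡⟨ cong₂ (λ b n → 𝟙 b + n) e (countᵇ-cong-local es) ⟩
  𝟙 (q x) + countᵇ q xs    ≡⟨ countᵇ-∷ q x xs ⟨
  countᵇ q (x ∷ xs)        ∎
  where open ≡-Reasoning

countᵇ-const-true : (xs : List A) → countᵇ (λ _ → true) xs ≡ length xs
countᵇ-const-true [] = refl
countᵇ-const-true (x ∷ xs) = cong suc (countᵇ-const-true xs)

countᵇ-picks : (p : A → Bool) (xs : List A) →
  All (λ (y , r) → countᵇ p xs ≡ 𝟙 (p y) + countᵇ p r) (picks xs)
countᵇ-picks p [] = []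
countᵇ-picks p (x ∷ xs) = countᵇ-∷ p x xs ∷ All.map⁺ (All.map (λ {(y , r)} e → begin
  countᵇ p (x ∷ xs)                ≡⟨ countᵇ-∷ p x xs ⟩
  𝟙 (p x) + countᵇ p xs            ≡⟨ cong (𝟙 (p x) +_) e ⟩
  𝟙 (p x) + (𝟙 (p y) + countᵇ p r) ≡⟨ x∙yz≈y∙xz (𝟙 (p x)) (𝟙 (p y)) _ ⟩
  𝟙 (p y) + (𝟙 (p x) + countᵇ p r) ≡⟨ cong (𝟙 (p y) +_) (countᵇ-∷ p x r) ⟨
  𝟙 (p y) + countᵇ p (x ∷ r)       ∎) (countᵇ-picks p xs))
  where open ≡-Reasoning

filterᵇ-∷ : (p : A → Bool) (x : A) (xs : List A) →
  filterᵇ p (x ∷ xs) ≡ (if p x then x ∷ filterᵇ p xs else filterᵇ p xs)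
filterᵇ-∷ p x xs with p x
... | true = refl
... | false = refl

∑-cong-local : {f g : A → ℕ} {xs : List A} → All (λ x → f x ≡ g x) xs → ∑ xs f ≡ ∑ xs g
∑-cong-local [] = refl
∑-cong-local (e ∷ es) = cong₂ _+_ e (∑-cong-local es)

∑-cong : {f g : A → ℕ} (xs : List A) → (∀ x → f x ≡ g x) → ∑ xs f ≡ ∑ xs g
∑-cong [] e = refl
∑-cong (x ∷ xs) e = cong₂ _+_ (e x) (∑-cong xs e)

∑-map : (g : A → B) (xs : List A) (f : B → ℕ) → ∑ (map g xs) f ≡ ∑[ x ∈ xs ] f (g x)
∑-map g [] f = refl
∑-map g (x ∷ xs) f = cong (f (g x) +_) (∑-map g xs f)

∑-+ : (xs : List A) (f g : A → ℕ) → ∑[ x ∈ xs ] (f x + g x) ≡ ∑ xs f + ∑ xs g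
∑-+ [] f g = refl
∑-+ (x ∷ xs) f g =
  trans (cong (f x + g x +_) (∑-+ xs f g)) (interchange (f x) (g x) (∑ xs f) (∑ xs g))

∑-*ˡ : (c : ℕ) (xs : List A) (f : A → ℕ) → ∑[ x ∈ xs ] (c * f x) ≡ c * ∑ xs f
∑-*ˡ c [] f = sym (*-zeroʳ c)
∑-*ˡ c (x ∷ xs) f = trans (cong (c * f x +_) (∑-*ˡ c xs f)) (sym (*-distribˡ-+ c (f x) (∑ xs f)))

concatMap-cong-local : {f g : A → List B} {xs : List A} →
  All (λ x → f x ≡ g x) xs → concatMap f xs ≡ concatMap g xs
concatMap-cong-local es = cong concat (map-cong-local es)

-- Counting pairings

picks-length : (xs : List A) → All (λ (y , r) → suc (length r) ≡ length xs) (picks xs)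
picks-length [] = []
picks-length (x ∷ xs) = refl ∷ All.map⁺ (All.map (cong suc) (picks-length xs))

picks-All : {P : A → Set} {xs : List A} → All P xs → All (λ (y , r) → P y × All P r) (picks xs)
picks-All [] = []
picks-All (px ∷ pxs) = (px , pxs) ∷ All.map⁺ (All.map (λ (py , pr) → py , px ∷ pr) (picks-All pxs))

pairingsF-fuel-irrelevant : ∀ k k' (xs : List ℕ) → length xs ≤ k → length xs ≤ k' →
  pairingsF k xs ≡ pairingsF k' xs
pairingsF-fuel-irrelevant k k' [] _ _ = refl
pairingsF-fuel-irrelevant (suc k) (suc k') (x ∷ xs) (s≤s h) (s≤s h') =
  concatMap-cong-local (All.map
    (λ {(y , r)} e → cong (map ((x , y) ∷_))
      (pairingsF-fuel-irrelevant k k' r (shorter r e h) (shorter r e h')))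
    (picks-length xs))
  where
  shorter : ∀ (r : List ℕ) {n} → suc (length r) ≡ length xs → length xs ≤ n → length r ≤ n
  shorter r e h = ≤-trans (n≤1+n _) (≤-trans (≤-reflexive e) h)

pairingCount : (MG → Bool) → List ℕ → ℕ
pairingCount Q S = countᵇ Q (pairings S)

pairingCount-∷ : (Q : MG → Bool) (x : ℕ) (xs : List ℕ) →
  pairingCount Q (x ∷ xs) ≡ ∑ (picks xs) λ (y , r) → pairingCount (Q ∘ ((x , y) ∷_)) r
pairingCount-∷ Q x xs =
  trans (countᵇ-concatMap Q _ (picks xs)) (∑-cong-local (All.map
    (λ {(y , r)} e → trans (countᵇ-map Q ((x , y) ∷_) (pairingsF (length xs) r))
      (cong (countᵇ (Q ∘ ((x , y) ∷_)))
        (pairingsF-fuel-irrelevant (length xs) (length r) r (≤-trans (n≤1+n _) (≤-reflexive e)) ≤-refl)))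
    (picks-length xs)))

EdgesWithin : (ℕ → Set) → MG → Set
EdgesWithin P G = All (λ (a , b) → P a × P b) G

pairingsF-edgesWithin : {P : ℕ → Set} (k : ℕ) {xs : List ℕ} → All P xs →
  All (EdgesWithin P) (pairingsF k xs)
pairingsF-edgesWithin k [] = [] ∷ []
pairingsF-edgesWithin zero (_ ∷ _) = []
pairingsF-edgesWithin (suc k) (px ∷ pxs) =
  All.concat⁺ (All.map⁺ (All.map
    (λ (py , pr) → All.map⁺ (All.map ((px , py) ∷_) (pairingsF-edgesWithin k pr)))
    (picks-All pxs)))

pairingCount-cong-within : (P : ℕ → Set) {Q Q' : MG → Bool} {S : List ℕ} → All P S →
  (∀ G → EdgesWithin P G → Q G ≡ Q' G) → pairingCount Q S ≡ pairingCount Q' S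
pairingCount-cong-within P pS e =
  countᵇ-cong-local (All.map (e _) (pairingsF-edgesWithin _ pS))

pairingCount-cong : {Q Q' : MG → Bool} (S : List ℕ) → (∀ G → Q G ≡ Q' G) →
  pairingCount Q S ≡ pairingCount Q' S
pairingCount-cong S e = countᵇ-cong-local (All.universal e (pairings S))

-- Reordering the edges of a multigraph

infix 4 _≈_

data _≈_ : MG → MG → Set where
  ≈-refl : ∀ {G} → G ≈ G
  ≈-trans : ∀ {F G H} → F ≈ G → G ≈ H → F ≈ H
  ≈-∷ : ∀ {F G} e → F ≈ G → e ∷ F ≈ e ∷ G
  ≈-swap : ∀ e e' F → e ∷ e' ∷ F ≈ e' ∷ e ∷ F
  ≈-flip : ∀ a b F → (a , b) ∷ F ≈ (b , a) ∷ F

Invariant : (MG → Bool) → Set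
Invariant Q = ∀ {F G} → F ≈ G → Q F ≡ Q G

EdgeSymmetric : {A : Set} → (Edge → A) → Set
EdgeSymmetric p = ∀ a b → p (a , b) ≡ p (b , a)

length-≈ : {F G : MG} → F ≈ G → length F ≡ length G
length-≈ ≈-refl = refl
length-≈ (≈-trans p q) = trans (length-≈ p) (length-≈ q)
length-≈ (≈-∷ e p) = cong suc (length-≈ p)
length-≈ (≈-swap e e' F) = refl
length-≈ (≈-flip a b F) = refl

filterᵇ-≈ : (p : Edge → Bool) → EdgeSymmetric p → {F G : MG} → F ≈ G → filterᵇ p F ≈ filterᵇ p G
filterᵇ-≈ p sym-p ≈-refl = ≈-refl
filterᵇ-≈ p sym-p (≈-trans q r) = ≈-trans (filterᵇ-≈ p sym-p q) (filterᵇ-≈ p sym-p r)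
filterᵇ-≈ p sym-p (≈-∷ e q) with p e
... | true = ≈-∷ e (filterᵇ-≈ p sym-p q)
... | false = filterᵇ-≈ p sym-p q
filterᵇ-≈ p sym-p (≈-swap e e' F)
  rewrite filterᵇ-∷ p e (e' ∷ F) | filterᵇ-∷ p e' (e ∷ F) | filterᵇ-∷ p e F | filterᵇ-∷ p e' F
  with p e | p e'
... | true | true = ≈-swap e e' _
... | true | false = ≈-refl
... | false | true = ≈-refl
... | false | false = ≈-refl
filterᵇ-≈ p sym-p (≈-flip a b F) with p (a , b) | p (b , a) | sym-p a b
... | true | .true | refl = ≈-flip a b _
... | false | .false | refl = ≈-refl

countᵇ-≈ : (p : Edge → Bool) → EdgeSymmetric p → {F G : MG} → F ≈ G → countᵇ p F ≡ countᵇ p G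
countᵇ-≈ p sym-p = length-≈ ∘ filterᵇ-≈ p sym-p

all-≈ : (p : Edge → Bool) → EdgeSymmetric p → {F G : MG} → F ≈ G → all p F ≡ all p G
all-≈ p sym-p ≈-refl = refl
all-≈ p sym-p (≈-trans q r) = trans (all-≈ p sym-p q) (all-≈ p sym-p r)
all-≈ p sym-p (≈-∷ e q) = cong (p e ∧_) (all-≈ p sym-p q)
all-≈ p sym-p (≈-swap e e' F) =
  trans (sym (∧-assoc (p e) (p e') _)) (trans (cong (_∧ all p F) (∧-comm (p e) (p e'))) (∧-assoc (p e') (p e) _))
all-≈ p sym-p (≈-flip a b F) = cong (_∧ all p F) (sym-p a b)

++-≈ : {F G : MG} (H : MG) → F ≈ G → F ++ H ≈ G ++ H
++-≈ H ≈-refl = ≈-refl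
++-≈ H (≈-trans p q) = ≈-trans (++-≈ H p) (++-≈ H q)
++-≈ H (≈-∷ e p) = ≈-∷ e (++-≈ H p)
++-≈ H (≈-swap e e' F) = ≈-swap e e' _
++-≈ H (≈-flip a b F) = ≈-flip a b _

configMG-≈ : (d : List ℕ) {F G : MG} → F ≈ G → configMG d F ≈ configMG d G
configMG-≈ d ≈-refl = ≈-refl
configMG-≈ d (≈-trans p q) = ≈-trans (configMG-≈ d p) (configMG-≈ d q)
configMG-≈ d (≈-∷ e p) = ≈-∷ _ (configMG-≈ d p)
configMG-≈ d (≈-swap e e' F) = ≈-swap _ _ _
configMG-≈ d (≈-flip a b F) = ≈-flip _ _ _

mult-≈ : ∀ e {F G} → F ≈ G → mult e F ≡ mult e G
mult-≈ (c , e) = countᵇ-≈ (edgeEqᵇ (c , e)) (λ a b → ∨-comm ((c ≡ᵇ a) ∧ (e ≡ᵇ b)) _)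

mult-flip : ∀ a b G → mult (a , b) G ≡ mult (b , a) G
mult-flip a b G = countᵇ-cong-local (All.universal flipped G)
  where
  flipped : ∀ x → edgeEqᵇ (a , b) x ≡ edgeEqᵇ (b , a) x
  flipped (c , e) rewrite ∧-comm (b ≡ᵇ c) (a ≡ᵇ e) | ∧-comm (b ≡ᵇ e) (a ≡ᵇ c) =
    ∨-comm ((a ≡ᵇ c) ∧ (b ≡ᵇ e)) _

sameMG-≈ : {F G : MG} (H : MG) → F ≈ G → sameMG F H ≡ sameMG G H
sameMG-≈ {F} {G} H p =
  trans (cong and (map-cong (λ e → cong (_≡ᵇ mult e H) (mult-≈ e p)) (F ++ H)))
        (all-≈ (λ e → mult e G ≡ᵇ mult e H)
          (λ a b → cong₂ _≡ᵇ_ (mult-flip a b G) (mult-flip a b H)) (++-≈ H p))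

-- Pairings with a marked pair

∑pairs : (ℕ → ℕ → List ℕ → ℕ) → List ℕ → ℕ
∑pairs h S = ∑ (picks S) λ (a , r) → ∑ (picks r) λ (b , r') → h a b r'

∑pairs-∷ : (h : ℕ → ℕ → List ℕ → ℕ) (s : ℕ) (S : List ℕ) →
  ∑pairs h (s ∷ S) ≡ ∑ (picks S) (λ (b , r) → h s b r)
                     + (∑ (picks S) (λ (a , r) → h a s r) + ∑pairs (λ a b r → h a b (s ∷ r)) S)
∑pairs-∷ h s S = cong (∑ (picks S) (λ (b , r) → h s b r) +_) (begin
  ∑ (map _ (picks S)) _
    ≡⟨ ∑-map _ (picks S) _ ⟩
  ∑ (picks S) (λ (a , r) → h a s r + ∑ (map _ (picks r)) _)
    ≡⟨ ∑-cong (picks S) (λ (a , r) → cong (h a s r +_) (∑-map _ (picks r) _)) ⟩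
  ∑ (picks S) (λ (a , r) → h a s r + ∑ (picks r) λ (b , r') → h a b (s ∷ r'))
    ≡⟨ ∑-+ (picks S) _ _ ⟩
  ∑ (picks S) (λ (a , r) → h a s r) + ∑pairs (λ a b r → h a b (s ∷ r)) S ∎)
  where open ≡-Reasoning

∑pairs-comm : (h : ℕ → ℕ → List ℕ → ℕ) (S : List ℕ) → ∑pairs h S ≡ ∑pairs (λ a b → h b a) S
∑pairs-comm h [] = refl
∑pairs-comm h (s ∷ S) = begin
  ∑pairs h (s ∷ S)
    ≡⟨ ∑pairs-∷ h s S ⟩
  X + (Y + ∑pairs (λ a b r → h a b (s ∷ r)) S)
    ≡⟨ cong (λ z → X + (Y + z)) (∑pairs-comm (λ a b r → h a b (s ∷ r)) S) ⟩
  X + (Y + ∑pairs (λ a b r → h b a (s ∷ r)) S)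
    ≡⟨ x∙yz≈y∙xz X Y _ ⟩
  Y + (X + ∑pairs (λ a b r → h b a (s ∷ r)) S)
    ≡⟨ ∑pairs-∷ (λ a b → h b a) s S ⟨
  ∑pairs (λ a b → h b a) (s ∷ S) ∎
  where
  open ≡-Reasoning
  X Y : ℕ
  X = ∑ (picks S) (λ (b , r) → h s b r)
  Y = ∑ (picks S) (λ (a , r) → h a s r)

∑triples : (ℕ → ℕ → ℕ → List ℕ → ℕ) → List ℕ → ℕ
∑triples h = ∑pairs (λ a b r → ∑ (picks r) λ (c , r') → h a b c r')

∑triples-rotate : (h : ℕ → ℕ → ℕ → List ℕ → ℕ) (S : List ℕ) →
  ∑triples h S ≡ ∑triples (λ a b c → h c a b) S
∑triples-rotate h S =
  trans (∑pairs-comm (λ a b r → ∑ (picks r) λ (c , r') → h a b c r') S)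
        (∑-cong (picks S) (λ (b , r) → ∑pairs-comm (λ a c → h a b c) r))

countWithPair : (MG → Bool) → ℕ → ℕ → List ℕ → ℕ
countWithPair Q a b = pairingCount (Q ∘ ((a , b) ∷_))

countWithPair-flip : (Q : MG → Bool) → Invariant Q → ∀ a b r → countWithPair Q a b r ≡ countWithPair Q b a r
countWithPair-flip Q inv a b r = pairingCount-cong r (λ G → inv (≈-flip a b G))

∑pairs-countWithPair-∷ : (Q : MG → Bool) → Invariant Q → (x : ℕ) (T : List ℕ) →
  ∑pairs (λ a b r → countWithPair Q a b (x ∷ r)) T
    ≡ ∑ (picks T) (λ (y , r) → ∑pairs (countWithPair (Q ∘ ((x , y) ∷_))) r)
∑pairs-countWithPair-∷ Q inv x T = trans
  (∑-cong (picks T) (λ (a , r) → ∑-cong (picks r) (λ (b , r') →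
    trans (pairingCount-∷ _ x r') (∑-cong (picks r') (λ (c , r'') →
      pairingCount-cong r'' (λ G → inv (≈-swap (a , b) (x , c) G)))))))
  (sym (∑triples-rotate (λ a → countWithPair (Q ∘ ((x , a) ∷_))) T))

-- Each pairing of S has length S / 2 pairs, each of which can be marked in 2 orientations.
∑pairs-countWithPair : (Q : MG → Bool) → Invariant Q → (S : List ℕ) →
  ∑pairs (countWithPair Q) S ≡ length S * pairingCount Q S
∑pairs-countWithPair Q inv S = bounded (suc (length S)) Q inv S ≤-refl
  where
  bounded : ∀ n (Q : MG → Bool) → Invariant Q → (S : List ℕ) → length S < n →
    ∑pairs (countWithPair Q) S ≡ length S * pairingCount Q S
  bounded n Q inv [] _ = refl
  bounded (suc n) Q inv (x ∷ T) (s≤s |T|<n) = begin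
    ∑pairs (countWithPair Q) (x ∷ T)
      ≡⟨ ∑pairs-∷ (countWithPair Q) x T ⟩
    ∑ (picks T) (λ (y , r) → countWithPair Q x y r)
      + (∑ (picks T) (λ (a , r) → countWithPair Q a x r)
         + ∑pairs (λ a b r → countWithPair Q a b (x ∷ r)) T)
      ≡⟨ cong₂ _+_ (sym (pairingCount-∷ Q x T))
           (cong₂ _+_ (∑-cong (picks T) (λ (a , r) → countWithPair-flip Q inv a x r))
                      (∑pairs-countWithPair-∷ Q inv x T)) ⟩
    N + (∑ (picks T) (λ (y , r) → countWithPair Q x y r)
         + ∑ (picks T) (λ (y , r) → ∑pairs (countWithPair (Q ∘ ((x , y) ∷_))) r))
      ≡⟨ cong (N +_) (sym (∑-+ (picks T) _ _)) ⟩
    N + ∑ (picks T) (λ (y , r) → countWithPair Q x y r + ∑pairs (countWithPair (Q ∘ ((x , y) ∷_))) r)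
      ≡⟨ cong (N +_) (∑-cong-local (All.map (λ {yr} → induction yr) (picks-length T))) ⟩
    N + ∑ (picks T) (λ (y , r) → length T * countWithPair Q x y r)
      ≡⟨ cong (N +_) (trans (∑-*ˡ (length T) (picks T) _) (cong (length T *_) (sym (pairingCount-∷ Q x T)))) ⟩
    N + length T * N ∎
    where
    open ≡-Reasoning
    N : ℕ
    N = pairingCount Q (x ∷ T)
    induction : ((y , r) : ℕ × List ℕ) → suc (length r) ≡ length T →
      countWithPair Q x y r + ∑pairs (countWithPair (Q ∘ ((x , y) ∷_))) r ≡ length T * countWithPair Q x y r
    induction (y , r) e = begin
      countWithPair Q x y r + ∑pairs (countWithPair (Q ∘ ((x , y) ∷_))) r
        ≡⟨ cong (countWithPair Q x y r +_)
             (bounded n _ (inv ∘ ≈-∷ (x , y)) r (≤-trans (≤-reflexive e) (≤-trans (n≤1+n _) |T|<n))) ⟩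
      suc (length r) * countWithPair Q x y r
        ≡⟨ cong (_* countWithPair Q x y r) e ⟩
      length T * countWithPair Q x y r ∎

-- A pairing of p ∷ q ∷ S either pairs p with q, or pairs p and q with some a, b ∈ S; the
-- latter pairings correspond to pairings of S with the marked pair (a , b).
pairingCount-contract : (P : ℕ → Set) {Q Q₂ : MG → Bool} → Invariant Q → (p q : ℕ) {S : List ℕ} →
  All P S →
  (∀ G → EdgesWithin P G → Q₂ ((p , q) ∷ G) ≡ Q G) →
  (∀ a b G → P a → P b → EdgesWithin P G → Q₂ ((p , a) ∷ (q , b) ∷ G) ≡ Q ((a , b) ∷ G)) →
  pairingCount Q₂ (p ∷ q ∷ S) ≡ suc (length S) * pairingCount Q S
pairingCount-contract P {Q} {Q₂} inv p q {S} pS pq-pair crossed-pairs = begin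
  pairingCount Q₂ (p ∷ q ∷ S)
    ≡⟨ pairingCount-∷ Q₂ p (q ∷ S) ⟩
  countWithPair Q₂ p q S + ∑ (map _ (picks S)) _
    ≡⟨ cong₂ _+_ (pairingCount-cong-within P pS pq-pair) (∑-map _ (picks S) _) ⟩
  pairingCount Q S + ∑ (picks S) (λ (a , r) → countWithPair Q₂ p a (q ∷ r))
    ≡⟨ cong (pairingCount Q S +_) (∑-cong-local (All.map (λ {(a , r)} (pa , pr) →
         trans (pairingCount-∷ (Q₂ ∘ ((p , a) ∷_)) q r) (∑-cong-local (All.map (λ (pb , pr') →
           pairingCount-cong-within P pr' (λ G → crossed-pairs _ _ G pa pb)) (picks-All pr))))
       (picks-All pS))) ⟩
  pairingCount Q S + ∑pairs (countWithPair Q) S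
    ≡⟨ cong (pairingCount Q S +_) (∑pairs-countWithPair Q inv S) ⟩
  pairingCount Q S + length S * pairingCount Q S ∎
  where open ≡-Reasoning

-- Suppressing a vertex

deg-≈ : (v : ℕ) {F G : MG} → F ≈ G → deg F v ≡ deg G v
deg-≈ v ≈-refl = refl
deg-≈ v (≈-trans p q) = trans (deg-≈ v p) (deg-≈ v q)
deg-≈ v (≈-∷ e p) = cong (_ +_) (deg-≈ v p)
deg-≈ v (≈-swap (a , b) (c , e) F) = x∙yz≈y∙xz (𝟙 (a ≡ᵇ v) + 𝟙 (b ≡ᵇ v)) (𝟙 (c ≡ᵇ v) + 𝟙 (e ≡ᵇ v)) (deg F v)
deg-≈ v (≈-flip a b F) = cong (_+ deg F v) (+-comm (𝟙 (a ≡ᵇ v)) (𝟙 (b ≡ᵇ v)))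

ends : ℕ → Edge → List ℕ
ends v (a , b) = otherEnds v ((a , b) ∷ [])

otherEnds-∷ : ∀ v e G → otherEnds v (e ∷ G) ≡ ends v e ++ otherEnds v G
otherEnds-∷ v (a , b) G with a ≡ᵇ v | b ≡ᵇ v
... | true | true = refl
... | true | false = refl
... | false | true = refl
... | false | false = refl

ends-flip : ∀ v a b → ends v (a , b) ≡ ends v (b , a)
ends-flip v a b with a ≡ᵇ v | b ≡ᵇ v
... | true | true = refl
... | true | false = refl
... | false | true = refl
... | false | false = refl

otherEnds-↭ : (v : ℕ) {F G : MG} → F ≈ G → otherEnds v F ↭ otherEnds v G
otherEnds-↭ v ≈-refl = ↭-refl
otherEnds-↭ v (≈-trans p q) = ↭-trans (otherEnds-↭ v p) (otherEnds-↭ v q)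
otherEnds-↭ v (≈-∷ {F} {G} e p) =
  subst₂ _↭_ (sym (otherEnds-∷ v e F)) (sym (otherEnds-∷ v e G)) (++⁺ˡ (ends v e) (otherEnds-↭ v p))
otherEnds-↭ v (≈-swap e e' F) =
  subst₂ _↭_ (sym (expand e e')) (sym (expand e' e)) (shifts (ends v e) (ends v e'))
  where
  expand : ∀ e e' → otherEnds v (e ∷ e' ∷ F) ≡ ends v e ++ ends v e' ++ otherEnds v F
  expand e e' = trans (otherEnds-∷ v e (e' ∷ F)) (cong (ends v e ++_) (otherEnds-∷ v e' F))
otherEnds-↭ v (≈-flip a b F) =
  subst₂ _↭_ (sym (otherEnds-∷ v (a , b) F))
    (sym (trans (otherEnds-∷ v (b , a) F) (cong (_++ otherEnds v F) (sym (ends-flip v a b))))) ↭-refl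

joinEnds : List ℕ → MG → MG
joinEnds (x ∷ y ∷ []) R = (x , y) ∷ R
joinEnds _ R = R

suppress-joinEnds : ∀ v G → suppress v G ≡ joinEnds (otherEnds v G) (filterᵇ (notIncident v) G)
suppress-joinEnds v G with otherEnds v G
... | [] = refl
... | x ∷ [] = refl
... | x ∷ y ∷ [] = refl
... | x ∷ y ∷ z ∷ zs = refl

data JoinEndsView : List ℕ → Set where
  two : ∀ x y → JoinEndsView (x ∷ y ∷ [])
  other : ∀ {L} → length L ≢ 2 → (∀ R → joinEnds L R ≡ R) → JoinEndsView L

joinEndsView : ∀ L → JoinEndsView L
joinEndsView [] = other (λ ()) (λ _ → refl)
joinEndsView (x ∷ []) = other (λ ()) (λ _ → refl)
joinEndsView (x ∷ y ∷ []) = two x y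
joinEndsView (x ∷ y ∷ z ∷ zs) = other (λ ()) (λ _ → refl)

singleton-↭-inv : ∀ {x y : ℕ} → x ∷ [] ↭ y ∷ [] → y ≡ x
singleton-↭-inv p with ↭-singleton-inv (↭-sym p)
... | refl = refl

two-↭-inv : ∀ {x y a b : ℕ} → x ∷ y ∷ [] ↭ a ∷ b ∷ [] → (a ≡ x × b ≡ y) ⊎ (a ≡ y × b ≡ x)
two-↭-inv {a = a} p with ∈-resp-↭ p (here refl)
... | here refl = inj₁ (refl , singleton-↭-inv (drop-mid [] [] p))
... | there (here refl) = inj₂ (singleton-↭-inv (drop-mid [] (a ∷ []) p) , refl)

joinEnds-↭ : ∀ {L L' R R'} → L ↭ L' → R ≈ R' → joinEnds L R ≈ joinEnds L' R'
joinEnds-↭ {L} {L'} {R} {R'} p r with joinEndsView L | joinEndsView L'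
... | two x y | two a b with two-↭-inv p
...   | inj₁ (refl , refl) = ≈-∷ _ r
...   | inj₂ (refl , refl) = ≈-trans (≈-∷ _ r) (≈-flip x y _)
joinEnds-↭ p r | two x y | other ≢2 _ = ⊥-elim (≢2 (sym (↭-length p)))
joinEnds-↭ p r | other ≢2 _ | two a b = ⊥-elim (≢2 (↭-length p))
joinEnds-↭ {R = R} {R'} p r | other _ e | other _ e' = subst₂ _≈_ (sym (e R)) (sym (e' R')) r

notIncident-symmetric : ∀ v → EdgeSymmetric (notIncident v)
notIncident-symmetric v a b = cong (λ z → if z then false else true) (∨-comm (a ≡ᵇ v) (b ≡ᵇ v))

suppress-≈ : ∀ v {F G} → F ≈ G → suppress v F ≈ suppress v G
suppress-≈ v {F} {G} p =
  subst₂ _≈_ (sym (suppress-joinEnds v F)) (sym (suppress-joinEnds v G))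
    (joinEnds-↭ (otherEnds-↭ v p) (filterᵇ-≈ (notIncident v) (notIncident-symmetric v) p))

kernelStep : MG → ℕ → MG
kernelStep H v = if deg H v ≡ᵇ 2 then suppress v H else H

kernelStep-≈ : ∀ v {F G} → F ≈ G → kernelStep F v ≈ kernelStep G v
kernelStep-≈ v {F} {G} p with deg F v ≡ᵇ 2 | deg G v ≡ᵇ 2 | cong (_≡ᵇ 2) (deg-≈ v p)
... | true | .true | refl = suppress-≈ v p
... | false | .false | refl = p

kernelSteps-≈ : ∀ vs {F G} → F ≈ G → foldl kernelStep F vs ≈ foldl kernelStep G vs
kernelSteps-≈ [] p = p
kernelSteps-≈ (v ∷ vs) p = kernelSteps-≈ vs (kernelStep-≈ v p)

Avoids : ℕ → MG → Set
Avoids v = EdgesWithin (λ u → (u ≡ᵇ v) ≡ false)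

deg-avoids : ∀ v {K} → Avoids v K → deg K v ≡ 0
deg-avoids v [] = refl
deg-avoids v {(a , b) ∷ K} ((a≢v , b≢v) ∷ av) rewrite a≢v | b≢v = deg-avoids v av

otherEnds-avoids : ∀ v {K} → Avoids v K → otherEnds v K ≡ []
otherEnds-avoids v [] = refl
otherEnds-avoids v {(a , b) ∷ K} ((a≢v , b≢v) ∷ av) rewrite a≢v | b≢v = otherEnds-avoids v av

filter-notIncident-avoids : ∀ v {K} → Avoids v K → filterᵇ (notIncident v) K ≡ K
filter-notIncident-avoids v [] = refl
filter-notIncident-avoids v {(a , b) ∷ K} ((a≢v , b≢v) ∷ av)
  rewrite filterᵇ-∷ (notIncident v) (a , b) K | a≢v | b≢v = cong ((a , b) ∷_) (filter-notIncident-avoids v av)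

kernelStep-loop : ∀ v {K} → Avoids v K → kernelStep ((v , v) ∷ K) v ≡ K
kernelStep-loop v {K} av
  rewrite ≡ᵇ-refl v | deg-avoids v av | otherEnds-avoids v av
        | filterᵇ-∷ (notIncident v) (v , v) K | ≡ᵇ-refl v
  = filter-notIncident-avoids v av

kernelStep-path : ∀ v a b {K} → (a ≡ᵇ v) ≡ false → (b ≡ᵇ v) ≡ false → Avoids v K →
  kernelStep ((v , a) ∷ (v , b) ∷ K) v ≡ (a , b) ∷ K
kernelStep-path v a b {K} a≢v b≢v av
  rewrite ≡ᵇ-refl v | a≢v | b≢v | deg-avoids v av | otherEnds-avoids v av
        | filterᵇ-∷ (notIncident v) (v , a) ((v , b) ∷ K) | filterᵇ-∷ (notIncident v) (v , b) K | ≡ᵇ-refl v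
  = cong ((a , b) ∷_) (filter-notIncident-avoids v av)

kernelSteps-skip : ∀ {K} vs → All (λ v → (deg K v ≡ᵇ 2) ≡ false) vs → foldl kernelStep K vs ≡ K
kernelSteps-skip [] [] = refl
kernelSteps-skip {K} (v ∷ vs) (≢2 ∷ ≢2s) rewrite ≢2 = kernelSteps-skip vs ≢2s

configMG-avoids : (d : List ℕ) (v : ℕ) {G : MG} →
  EdgesWithin (λ u → (φ d u ≡ᵇ v) ≡ false) G → Avoids v (configMG d G)
configMG-avoids d v = All.map⁺

deg-configMG : (d : List ℕ) (v : ℕ) (k : ℕ) (S : List ℕ) →
  All (λ G → deg (configMG d G) v ≡ countᵇ (λ w → φ d w ≡ᵇ v) S) (pairingsF k S)
deg-configMG d v k [] = refl ∷ []
deg-configMG d v zero (x ∷ xs) = []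
deg-configMG d v (suc k) (x ∷ xs) =
  All.concat⁺ (All.map⁺ (All.map (λ {(y , r)} e → All.map⁺ (All.map (λ {G} deg≡ → begin
    𝟙 (p x) + 𝟙 (p y) + deg (configMG d G) v ≡⟨ cong (𝟙 (p x) + 𝟙 (p y) +_) deg≡ ⟩
    𝟙 (p x) + 𝟙 (p y) + countᵇ p r          ≡⟨ +-assoc (𝟙 (p x)) (𝟙 (p y)) _ ⟩
    𝟙 (p x) + (𝟙 (p y) + countᵇ p r)        ≡⟨ cong (𝟙 (p x) +_) e ⟨
    𝟙 (p x) + countᵇ p xs                   ≡⟨ countᵇ-∷ p x xs ⟨
    countᵇ p (x ∷ xs)                       ∎)
    (deg-configMG d v k r)))
  (countᵇ-picks p xs)))
  where
  open ≡-Reasoning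
  p : ℕ → Bool
  p w = φ d w ≡ᵇ v

-- Cells of the configuration

applyUpTo-iterate : (f : ℕ → ℕ) (a n : ℕ) → (∀ i → f i ≡ a + i) → applyUpTo f n ≡ iterate suc a n
applyUpTo-iterate f a zero e = refl
applyUpTo-iterate f a (suc n) e =
  cong₂ _∷_ (trans (e 0) (+-identityʳ a))
    (applyUpTo-iterate (f ∘ suc) (suc a) n (λ i → trans (e (suc i)) (+-suc a i)))

map-suc-upTo : ∀ n → map suc (upTo n) ≡ iterate suc 1 n
map-suc-upTo n = trans (map-upTo suc n) (applyUpTo-iterate suc 1 n (λ _ → refl))

iterate-suc-All : {P : ℕ → Set} (a n : ℕ) → (∀ i → i < n → P (a + i)) → All P (iterate suc a n)
iterate-suc-All a zero h = []
iterate-suc-All {P} a (suc n) h =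
  subst P (+-identityʳ a) (h 0 (s≤s z≤n))
    ∷ iterate-suc-All (suc a) n (λ i i<n → subst P (+-suc a i) (h (suc i) (s≤s i<n)))

iterate-suc-+ : ∀ a m n → iterate suc a (m + n) ≡ iterate suc a m ++ iterate suc (a + m) n
iterate-suc-+ a zero n = cong (λ b → iterate suc b n) (sym (+-identityʳ a))
iterate-suc-+ a (suc m) n =
  cong (a ∷_) (trans (iterate-suc-+ (suc a) m n) (cong (λ b → iterate suc (suc a) m ++ iterate suc b n) (sym (+-suc a m))))

iterate-suc-shift : ∀ x a n → iterate suc (x + a) n ≡ map (x +_) (iterate suc a n)
iterate-suc-shift x a zero = refl
iterate-suc-shift x a (suc n) =
  cong ((x + a) ∷_) (trans (cong (λ b → iterate suc b n) (sym (+-suc x a))) (iterate-suc-shift x (suc a) n))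

iterate-suc-from : ∀ x n → iterate suc (suc x) n ≡ map (x +_) (iterate suc 1 n)
iterate-suc-from x n = trans (cong (λ a → iterate suc a n) (+-comm 1 x)) (iterate-suc-shift x 1 n)

φ-∷-beyond : ∀ x xs w → φ (x ∷ xs) (x + suc w) ≡ suc (φ xs (suc w))
φ-∷-beyond x xs w with (x + suc w) ≤ᵇ x in eq
... | true = ⊥-elim (m+1+n≰m x (≤ᵇ⇒≤ (x + suc w) x (subst T (sym eq) tt)))
... | false = cong (suc ∘ φ xs) (m+n∸m≡n x (suc w))

φ-++ : ∀ ds e w → φ (ds ++ e) (sum ds + suc w) ≡ length ds + φ e (suc w)
φ-++ [] e w = refl
φ-++ (x ∷ ds) e w = begin
  φ (x ∷ ds ++ e) (x + sum ds + suc w)     ≡⟨ cong (φ (x ∷ ds ++ e)) (trans (+-assoc x _ _) (cong (x +_) (+-suc (sum ds) w))) ⟩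
  φ (x ∷ ds ++ e) (x + suc (sum ds + w))   ≡⟨ φ-∷-beyond x (ds ++ e) (sum ds + w) ⟩
  suc (φ (ds ++ e) (suc (sum ds + w)))     ≡⟨ cong (suc ∘ φ (ds ++ e)) (+-suc (sum ds) w) ⟨
  suc (φ (ds ++ e) (sum ds + suc w))       ≡⟨ cong suc (φ-++ ds e w) ⟩
  suc (length ds + φ e (suc w))            ∎
  where open ≡-Reasoning

φ-positive : ∀ ds {w} → 0 < w → w ≤ sum ds → 0 < φ ds w
φ-positive [] {suc w} _ ()
φ-positive (x ∷ ds) {w} _ _ with w ≤ᵇ x
... | true = s≤s z≤n
... | false = s≤s z≤n

φ-++-≤ : ∀ ds e {w} → 0 < w → w ≤ sum ds → φ (ds ++ e) w ≤ length ds
φ-++-≤ [] e {suc w} _ ()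
φ-++-≤ (x ∷ ds) e {w} 0<w w≤ with w ≤ᵇ x in eq
... | true = s≤s z≤n
... | false = s≤s (φ-++-≤ ds e (m<n⇒0<n∸m x<w) (m≤n+o⇒m∸n≤o w x w≤))
  where
  x<w : x < w
  x<w = ≰⇒> (λ w≤x → subst T eq (≤⇒≤ᵇ w≤x))

cellSize : List ℕ → ℕ → ℕ
cellSize ds v = countᵇ (λ w → φ ds w ≡ᵇ v) (iterate suc 1 (sum ds))

cellSize-≥ : ∀ k ds → All (k ≤_) ds → All (λ v → k ≤ cellSize ds v) (iterate suc 1 (length ds))
cellSize-≥ k [] [] = []
cellSize-≥ k (x ∷ ds) (k≤x ∷ k≤ds) rewrite iterate-suc-+ 1 x (sum ds) =
  first ∷ subst (All _) (sym (iterate-suc-from 1 (length ds)))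
            (All.map⁺ (All.map (λ {v} → later v) (cellSize-≥ k ds k≤ds)))
  where
  p : ℕ → ℕ → Bool
  p v w = φ (x ∷ ds) w ≡ᵇ v
  front back : List ℕ
  front = iterate suc 1 x
  back = iterate suc (suc x) (sum ds)
  first-cell : countᵇ (p 1) front ≡ x
  first-cell =
    trans (countᵇ-cong-local {q = λ _ → true} (iterate-suc-All 1 x (λ i i<x →
             cong (λ b → (if b then 1 else suc (φ ds (suc i ∸ x))) ≡ᵇ 1) (T⇒≡true (≤⇒≤ᵇ i<x)))))
      (trans (countᵇ-const-true front) (length-iterate suc 1 x))
  later-cells : ∀ v → countᵇ (p (suc v)) back ≡ cellSize ds v
  later-cells v = begin
    countᵇ (p (suc v)) back
      ≡⟨ cong (countᵇ (p (suc v))) (iterate-suc-from x (sum ds)) ⟩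
    countᵇ (p (suc v)) (map (x +_) (iterate suc 1 (sum ds)))
      ≡⟨ countᵇ-map (p (suc v)) (x +_) (iterate suc 1 (sum ds)) ⟩
    countᵇ (p (suc v) ∘ (x +_)) (iterate suc 1 (sum ds))
      ≡⟨ countᵇ-cong-local (iterate-suc-All 1 (sum ds) (λ i _ → cong (_≡ᵇ suc v) (φ-∷-beyond x ds i))) ⟩
    cellSize ds v ∎
    where open ≡-Reasoning
  first : k ≤ countᵇ (p 1) (front ++ back)
  first = begin
    k                                       ≤⟨ k≤x ⟩
    x                                       ≡⟨ first-cell ⟨
    countᵇ (p 1) front                      ≤⟨ m≤m+n _ _ ⟩
    countᵇ (p 1) front + countᵇ (p 1) back  ≡⟨ countᵇ-++ (p 1) front back ⟨
    countᵇ (p 1) (front ++ back)            ∎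
    where open ≤-Reasoning
  later : ∀ v → k ≤ cellSize ds v → k ≤ countᵇ (p (suc v)) (front ++ back)
  later v k≤ = begin
    k                                                   ≤⟨ k≤ ⟩
    cellSize ds v                                       ≡⟨ later-cells v ⟨
    countᵇ (p (suc v)) back                             ≤⟨ m≤n+m _ _ ⟩
    countᵇ (p (suc v)) front + countᵇ (p (suc v)) back  ≡⟨ countᵇ-++ (p (suc v)) front back ⟨
    countᵇ (p (suc v)) (front ++ back)                  ∎
    where open ≤-Reasoning

sum-replicate-2 : ∀ n → sum (replicate n 2) ≡ n + n
sum-replicate-2 zero = refl
sum-replicate-2 (suc n) = cong suc (trans (cong suc (sum-replicate-2 n)) (sym (+-suc n n)))

sum-replicate-2-++ : ∀ n xs → sum (replicate n 2 ++ xs) ≡ n + n + sum xs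
sum-replicate-2-++ n xs = trans (sum-++ (replicate n 2) xs) (cong (_+ sum xs) (sum-replicate-2 n))

replicate-+-++ : ∀ m n (x : A) xs → replicate (m + n) x ++ xs ≡ replicate m x ++ replicate n x ++ xs
replicate-+-++ zero n x xs = refl
replicate-+-++ (suc m) n x xs = cong (x ∷_) (replicate-+-++ m n x xs)

φ-replicate-++ : ∀ j xs w → φ (replicate j 2 ++ xs) (j + j + suc w) ≡ j + φ xs (suc w)
φ-replicate-++ j xs w =
  subst₂ (λ s l → φ (replicate j 2 ++ xs) (s + suc w) ≡ l + φ xs (suc w))
    (sum-replicate-2 j) (length-replicate j) (φ-++ (replicate j 2) xs w)

φ-replicate-++-≤ : ∀ j xs {w} → 0 < w → w ≤ j + j → φ (replicate j 2 ++ xs) w ≤ j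
φ-replicate-++-≤ j xs {w} 0<w w≤ =
  subst (φ (replicate j 2 ++ xs) w ≤_) (length-replicate j)
    (φ-++-≤ (replicate j 2) xs 0<w (subst (w ≤_) (sym (sum-replicate-2 j)) w≤))

3≤⇒≢2 : ∀ {x} → 3 ≤ x → x ≢ 2
3≤⇒≢2 (s≤s (s≤s ())) refl

nu2-≥3 : ∀ {e} → All (3 ≤_) e → nu2 e ≡ 0
nu2-≥3 [] = refl
nu2-≥3 {x ∷ e} (3≤x ∷ 3≤e) rewrite ≡ᵇ-false (3≤⇒≢2 3≤x) = nu2-≥3 3≤e

sorted-degrees-split : (d : List ℕ) → Linked _≤_ d → All (2 ≤_) d →
  ∃ λ e → d ≡ replicate (nu2 d) 2 ++ e × All (3 ≤_) e
sorted-degrees-split [] _ _ = [] , refl , []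
sorted-degrees-split (zero ∷ d) _ (() ∷ _)
sorted-degrees-split (1 ∷ d) _ (s≤s () ∷ _)
sorted-degrees-split (2 ∷ d) sorted (_ ∷ 2≤d) with sorted-degrees-split d (Linked.tail sorted) 2≤d
... | e , d≡ , 3≤e = e , cong (2 ∷_) d≡ , 3≤e
sorted-degrees-split (x@(suc (suc (suc _))) ∷ d) sorted _ =
  x ∷ d , cong (λ n → replicate n 2 ++ x ∷ d) (sym (nu2-≥3 3≤xd)) , 3≤xd
  where
  3≤xd : All (3 ≤_) (x ∷ d)
  3≤xd = Linked⇒All ≤-trans (s≤s (s≤s (s≤s z≤n))) sorted

KernelLaw : List ℕ → ℕ → MG → Set
KernelLaw d k H =
  countᵇ (λ F → sameMG (kernel (length d) (configMG d F)) H) (pairings (points d))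
    * length (pairings (pointsAbove d k))
  ≡ countᵇ (λ F → sameMG (configMG d F) H) (pairings (pointsAbove d k))
    * length (pairings (points d))

-- Stage (j , k), with j + k = ν: the cells 1, …, j are suppressed and k cells of size 2 remain.
module Contraction (ν : ℕ) (e : List ℕ) (3≤e : All (3 ≤_) e) (H : MG) where

  d : List ℕ
  d = replicate ν 2 ++ e

  pointsFrom : ℕ → ℕ → List ℕ
  pointsFrom j k = iterate suc (suc (j + j)) (k + k + sum e)

  verticesFrom : ℕ → ℕ → List ℕ
  verticesFrom j k = iterate suc (suc j) (k + length e)

  KernelIs : ℕ → ℕ → MG → Bool
  KernelIs j k F = sameMG (foldl kernelStep (configMG d F) (verticesFrom j k)) H

  Ŵ : List ℕ
  Ŵ = pointsFrom ν 0

  R̂ : ℕ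
  R̂ = pairingCount (λ F → sameMG (configMG d F) H) Ŵ

  P̂ : ℕ
  P̂ = length (pairings Ŵ)

  KernelIs-invariant : ∀ j k → Invariant (KernelIs j k)
  KernelIs-invariant j k p = sameMG-≈ H (kernelSteps-≈ (verticesFrom j k) (configMG-≈ d p))

  pointsFrom-suc : ∀ j k → pointsFrom j (suc k) ≡ suc (j + j) ∷ suc (suc (j + j)) ∷ pointsFrom (suc j) k
  pointsFrom-suc j k =
    trans (cong (λ n → iterate suc (suc (j + j)) (suc n + sum e)) (+-suc k k))
      (cong (λ a → suc (j + j) ∷ suc (suc (j + j)) ∷ iterate suc a (k + k + sum e))
        (cong (suc ∘ suc) (sym (+-suc j j))))

  module Cell (j k : ℕ) (j+1+k≡ν : j + suc k ≡ ν) where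

    NotInCell : ℕ → Set
    NotInCell u = (φ d u ≡ᵇ suc j) ≡ false

    φ-cell : ∀ w → w < 2 → φ d (j + j + suc w) ≡ suc j
    φ-cell w w<2 = begin
      φ d (j + j + suc w)                                ≡⟨ cong (λ n → φ (replicate n 2 ++ e) _) (sym j+1+k≡ν) ⟩
      φ (replicate (j + suc k) 2 ++ e) (j + j + suc w)   ≡⟨ cong (λ xs → φ xs _) (replicate-+-++ j (suc k) 2 e) ⟩
      φ (replicate j 2 ++ 2 ∷ rest) (j + j + suc w)      ≡⟨ φ-replicate-++ j (2 ∷ rest) w ⟩
      j + φ (2 ∷ rest) (suc w)                           ≡⟨ cong (j +_) (first-cell w w<2) ⟩
      j + 1                                              ≡⟨ +-comm j 1 ⟩
      suc j                                              ∎
      where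
      open ≡-Reasoning
      rest : List ℕ
      rest = replicate k 2 ++ e
      first-cell : ∀ w → w < 2 → φ (2 ∷ rest) (suc w) ≡ 1
      first-cell 0 _ = refl
      first-cell 1 _ = refl
      first-cell (suc (suc _)) (s≤s (s≤s ()))

    later-points : All NotInCell (pointsFrom (suc j) k)
    later-points = iterate-suc-All _ _ (λ i i< → ≡ᵇ-false (λ φ≡ → <-irrefl (sym φ≡) (beyond i i<)))
      where
      beyond : ∀ i → i < k + k + sum e → suc j < φ d (suc (suc j + suc j) + i)
      beyond i i< = begin-strict
        suc j
          <⟨ m<m+n (suc j) (φ-positive rest (s≤s z≤n) (subst (suc i ≤_) (sym (sum-replicate-2-++ k e)) i<)) ⟩
        suc j + φ rest (suc i)
          ≡⟨ φ-replicate-++ (suc j) rest i ⟨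
        φ (replicate (suc j) 2 ++ rest) (suc j + suc j + suc i)
          ≡⟨ cong₂ φ (trans (sym (replicate-+-++ (suc j) k 2 e))
                            (cong (λ n → replicate n 2 ++ e) (trans (sym (+-suc j k)) j+1+k≡ν)))
                     (+-suc (suc j + suc j) i) ⟩
        φ d (suc (suc j + suc j) + i)
          ∎
        where
        open ≤-Reasoning
        rest : List ℕ
        rest = replicate k 2 ++ e

    p q : ℕ
    p = suc (j + j)
    q = suc (suc (j + j))

    φp : φ d p ≡ suc j
    φp = trans (cong (φ d) (+-comm 1 (j + j))) (φ-cell 0 (s≤s z≤n))

    φq : φ d q ≡ suc j
    φq = trans (cong (φ d) (+-comm 2 (j + j))) (φ-cell 1 (s≤s (s≤s z≤n)))

    contract : {Q₂ Q : MG → Bool} → Invariant Q →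
      (∀ G → EdgesWithin NotInCell G → Q₂ ((p , q) ∷ G) ≡ Q G) →
      (∀ a b G → NotInCell a → NotInCell b → EdgesWithin NotInCell G →
        Q₂ ((p , a) ∷ (q , b) ∷ G) ≡ Q ((a , b) ∷ G)) →
      pairingCount Q₂ (pointsFrom j (suc k))
        ≡ suc (length (pointsFrom (suc j) k)) * pairingCount Q (pointsFrom (suc j) k)
    contract {Q₂} inv loop crossed =
      trans (cong (pairingCount Q₂) (pointsFrom-suc j k))
        (pairingCount-contract NotInCell inv p q later-points loop crossed)

    kernelIs-contract : pairingCount (KernelIs j (suc k)) (pointsFrom j (suc k))
      ≡ suc (length (pointsFrom (suc j) k)) * pairingCount (KernelIs (suc j) k) (pointsFrom (suc j) k)
    kernelIs-contract = contract (KernelIs-invariant (suc j) k)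
      (λ G G∉ → cong finish (begin
        kernelStep ((φ d p , φ d q) ∷ configMG d G) (suc j)
          ≡⟨ cong₂ (λ a b → kernelStep ((a , b) ∷ configMG d G) (suc j)) φp φq ⟩
        kernelStep ((suc j , suc j) ∷ configMG d G) (suc j)
          ≡⟨ kernelStep-loop (suc j) (configMG-avoids d (suc j) G∉) ⟩
        configMG d G ∎))
      (λ a b G a∉ b∉ G∉ → cong finish (begin
        kernelStep ((φ d p , φ d a) ∷ (φ d q , φ d b) ∷ configMG d G) (suc j)
          ≡⟨ cong₂ (λ x y → kernelStep ((x , φ d a) ∷ (y , φ d b) ∷ configMG d G) (suc j)) φp φq ⟩
        kernelStep ((suc j , φ d a) ∷ (suc j , φ d b) ∷ configMG d G) (suc j)
          ≡⟨ kernelStep-path (suc j) (φ d a) (φ d b) a∉ b∉ (configMG-avoids d (suc j) G∉) ⟩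
        (φ d a , φ d b) ∷ configMG d G ∎))
      where
      open ≡-Reasoning
      finish : MG → Bool
      finish K = sameMG (foldl kernelStep K (verticesFrom (suc j) k)) H

    pairings-contract : length (pairings (pointsFrom j (suc k)))
      ≡ suc (length (pointsFrom (suc j) k)) * length (pairings (pointsFrom (suc j) k))
    pairings-contract = begin
      length (pairings (pointsFrom j (suc k)))
        ≡⟨ countᵇ-const-true (pairings (pointsFrom j (suc k))) ⟨
      countᵇ (λ _ → true) (pairings (pointsFrom j (suc k)))
        ≡⟨ contract (λ _ → refl) (λ _ _ → refl) (λ _ _ _ _ _ _ → refl) ⟩
      suc (length (pointsFrom (suc j) k)) * countᵇ (λ _ → true) (pairings (pointsFrom (suc j) k))
        ≡⟨ cong (suc (length (pointsFrom (suc j) k)) *_) (countᵇ-const-true (pairings (pointsFrom (suc j) k))) ⟩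
      suc (length (pointsFrom (suc j) k)) * length (pairings (pointsFrom (suc j) k)) ∎
      where open ≡-Reasoning

  Ŵ-cellSize : ∀ v → countᵇ (λ w → φ d w ≡ᵇ (ν + v)) Ŵ ≡ cellSize e v
  Ŵ-cellSize v = begin
    countᵇ (λ w → φ d w ≡ᵇ (ν + v)) Ŵ
      ≡⟨ cong (countᵇ _) (iterate-suc-from (ν + ν) (sum e)) ⟩
    countᵇ (λ w → φ d w ≡ᵇ (ν + v)) (map (ν + ν +_) (iterate suc 1 (sum e)))
      ≡⟨ countᵇ-map _ (ν + ν +_) (iterate suc 1 (sum e)) ⟩
    countᵇ (λ w → φ d (ν + ν + w) ≡ᵇ (ν + v)) (iterate suc 1 (sum e))
      ≡⟨ countᵇ-cong-local (iterate-suc-All 1 (sum e) (λ i _ →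
           trans (cong (_≡ᵇ (ν + v)) (φ-replicate-++ ν e i)) (≡ᵇ-cancelˡ ν _ v))) ⟩
    cellSize e v ∎
    where open ≡-Reasoning

  degrees-≢2 : ∀ {F} → F ∈ pairings Ŵ → All (λ v → (deg (configMG d F) v ≡ᵇ 2) ≡ false) (verticesFrom ν 0)
  degrees-≢2 {F} F∈ =
    subst (All _) (sym (iterate-suc-from ν (length e)))
      (All.map⁺ (All.map (λ {v} 3≤ → ≡ᵇ-false (3≤⇒≢2 (subst (3 ≤_) (sym (deg≡ v)) 3≤)))
        (cellSize-≥ 3 e 3≤e)))
    where
    deg≡ : ∀ v → deg (configMG d F) (ν + v) ≡ cellSize e v
    deg≡ v = trans (All.lookup (deg-configMG d (ν + v) _ Ŵ) F∈) (Ŵ-cellSize v)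

  kernelIs-done : pairingCount (KernelIs ν 0) Ŵ ≡ R̂
  kernelIs-done = countᵇ-cong-local (All.tabulate (λ F∈ →
    cong (λ K → sameMG K H) (kernelSteps-skip (verticesFrom ν 0) (degrees-≢2 F∈))))

  contraction : ∀ k j → j + k ≡ ν →
    pairingCount (KernelIs j k) (pointsFrom j k) * P̂ ≡ R̂ * length (pairings (pointsFrom j k))
  contraction zero j j+0≡ν with trans (sym (+-identityʳ j)) j+0≡ν
  ... | refl = cong (_* P̂) kernelIs-done
  contraction (suc k) j j+1+k≡ν = begin
    pairingCount (KernelIs j (suc k)) (pointsFrom j (suc k)) * P̂
      ≡⟨ cong (_* P̂) kernelIs-contract ⟩
    c * N * P̂   ≡⟨ *-assoc c N P̂ ⟩
    c * (N * P̂) ≡⟨ cong (c *_) (contraction k (suc j) (trans (sym (+-suc j k)) j+1+k≡ν)) ⟩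
    c * (R̂ * L) ≡⟨ *-x∙yz≈y∙xz c R̂ L ⟩
    R̂ * (c * L) ≡⟨ cong (R̂ *_) pairings-contract ⟨
    R̂ * length (pairings (pointsFrom j (suc k))) ∎
    where
    open ≡-Reasoning
    open Cell j k j+1+k≡ν
    c N L : ℕ
    c = suc (length (pointsFrom (suc j) k))
    N = pairingCount (KernelIs (suc j) k) (pointsFrom (suc j) k)
    L = length (pairings (pointsFrom (suc j) k))

  points≡ : points d ≡ pointsFrom 0 ν
  points≡ = trans (map-suc-upTo (sum d)) (cong (iterate suc 1) (sum-replicate-2-++ ν e))

  pointsAbove≡ : pointsAbove d ν ≡ Ŵ
  pointsAbove≡ = begin
    filterᵇ above (points d)
      ≡⟨ cong (filterᵇ above) (trans points≡ (iterate-suc-+ 1 (ν + ν) (sum e))) ⟩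
    filterᵇ above (iterate suc 1 (ν + ν) ++ Ŵ)
      ≡⟨ filter-++ (T? ∘ above) (iterate suc 1 (ν + ν)) Ŵ ⟩
    filterᵇ above (iterate suc 1 (ν + ν)) ++ filterᵇ above Ŵ
      ≡⟨ cong₂ _++_ (filter-none (T? ∘ above) (iterate-suc-All 1 (ν + ν) (λ i i< t →
           ≤⇒≯ (φ-replicate-++-≤ ν e (s≤s z≤n) i<) (<ᵇ⇒< ν _ t))))
         (filter-all (T? ∘ above) (iterate-suc-All (suc (ν + ν)) (sum e) (λ i i< →
           <⇒<ᵇ (subst (ν <_) (sym (φ-beyond i)) (m<m+n ν (φ-positive e (s≤s z≤n) i<)))))) ⟩
    Ŵ ∎
    where
    open ≡-Reasoning
    above : ℕ → Bool
    above w = ν <ᵇ φ d w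
    φ-beyond : ∀ i → φ d (suc (ν + ν) + i) ≡ ν + φ e (suc i)
    φ-beyond i = trans (cong (φ d) (sym (+-suc (ν + ν) i))) (φ-replicate-++ ν e i)

  vertices≡ : map suc (upTo (length d)) ≡ verticesFrom 0 ν
  vertices≡ = trans (map-suc-upTo (length d))
    (cong (iterate suc 1) (trans (length-++ (replicate ν 2)) (cong (_+ length e) (length-replicate ν))))

  theorem : KernelLaw d ν H
  theorem rewrite pointsAbove≡ | points≡ = begin
    pairingCount (λ F → sameMG (kernel (length d) (configMG d F)) H) (pointsFrom 0 ν) * P̂
      ≡⟨ cong (_* P̂) (pairingCount-cong (pointsFrom 0 ν) (λ F →
           cong (λ vs → sameMG (foldl kernelStep (configMG d F) vs) H) vertices≡)) ⟩
    pairingCount (KernelIs 0 ν) (pointsFrom 0 ν) * P̂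
      ≡⟨ contraction ν 0 refl ⟩
    R̂ * length (pairings (pointsFrom 0 ν)) ∎
    where open ≡-Reasoning

lemma1 : (d : List ℕ) (m : ℕ) → Linked _≤_ d → All (2 ≤_) d → sum d ≡ 2 * m →
    (H : MG) →
    countᵇ (λ F → sameMG (kernel (length d) (configMG d F)) H) (pairings (points d))
      * length (pairings (pointsAbove d (nu2 d)))
    ≡ countᵇ (λ F → sameMG (configMG d F) H) (pairings (pointsAbove d (nu2 d)))
      * length (pairings (points d))
lemma1 d _ sorted 2≤d _ H with sorted-degrees-split d sorted 2≤d
... | e , d≡ , 3≤e = subst (λ d′ → KernelLaw d′ (nu2 d) H) (sym d≡) (Contraction.theorem (nu2 d) e 3≤e H)
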